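{- Let $(G_1,\ldots,G_T,\mathcal{D})$ be an instance of Monotonic Single-Source $k$-DTSN with $G_t=(V,E_t)$, edge weights $w$, and demands $\mathcal{D}=\{(a,b_i,t_i): i\in[k]\}$. Construct the Directed Steiner Tree instance $(G',D')$ as follows: $G'$ has a vertex $v^j$ for each $v\in V$ and $j\in[T]$; an edge $(u^j,v^j)$ of weight $w(u,v)$ for each $j\in[T]$ and each $(u,v)\in E_j$; and a zero-weight edge $(v^j,v^{j+1})$ for each $v\in V$ and $j\in[T-1]$. The demands are $D'=\{(a^1,b_i^{t_i}) : i\in[k]\}$. If $(G',D')$ has a feasible solution (a subgraph of $G'$ containing a directed path from $a^1$ to $b_i^{t_i}$ for every $i$) of cost $C$, then the $k$-DTSN instance has a feasible solution of cost at most $C$.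
   Context: Monotonic Single-Source $k$-DTSN: directed frames $G_1=(V,E_1),\ldots,G_T=(V,E_T)$ on a common vertex set with $E_t\subseteq E_{t'}$ whenever $t\le t'$, weights $w(e)\ge0$ on $E=\bigcup_tE_t$, and demands $(a,b_i,t_i)$, $i\in[k]$, with common root $a$. A feasible solution is a subgraph $\mathcal{H}$ of $(V,E)$ that, for each $i$, contains a directed $a\to b_i$ path all of whose edges lie in $E_{t_i}$; its cost is its total edge weight.
   Formalization: The edge weights $w$ take nonnegative rational values. -}

module Defs where

open import Data.Nat using (ℕ; zero; suc)
open import Data.Fin using (Fin; zero; suc; toℕ)
open import Data.Bool using (Bool; true; false; if_then_else_)
open import Data.Product using (_×_; _,_; ∃-syntax)
open import Data.Sum using (_⊎_)
open import Data.Rational using (ℚ; 0ℚ; _+_; _≤_)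
open import Relation.Nullary.Decidable using (⌊_⌋)
open import Relation.Binary.PropositionalEquality using (_≡_)
import Data.Fin as F

sumFin : (n : ℕ) → (Fin n → ℚ) → ℚ
sumFin zero    f = 0ℚ
sumFin (suc n) f = f zero + sumFin n (λ i → f (suc i))

data Path {V : Set} (R : V → V → Set) : V → V → Set where
  here : ∀ {x} → Path R x x
  step : ∀ {x y z} → R x y → Path R y z → Path R x z

-- Instance of Monotonic Single-Source k-DTSN.
-- Vertices Fin n; frames indexed by Fin T (index j stands for frame j+1);
-- E j u v ≡ true means (u,v) ∈ E_{j+1}.

Frames : ℕ → ℕ → Set
Frames n T = Fin T → Fin n → Fin n → Bool

Monotone : ∀ {n T} → Frames n T → Set
Monotone {n} {T} E =
  ∀ (t t' : Fin T) (u v : Fin n) → toℕ t Data.Nat.≤ toℕ t' → E t u v ≡ true → E t' u v ≡ true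

InUnion : ∀ {n T} → Frames n T → Fin n → Fin n → Set
InUnion E u v = ∃[ t ] (E t u v ≡ true)

Subgraph : ℕ → Set
Subgraph n = Fin n → Fin n → Bool

cost : ∀ {n} → (Fin n → Fin n → ℚ) → Subgraph n → ℚ
cost {n} w H = sumFin n λ u → sumFin n λ v → if H u v then w u v else 0ℚ

V' : ℕ → ℕ → Set
V' n T = Fin n × Fin T

Edge' : ∀ {n T} → Frames n T → V' n T → V' n T → Set
Edge' E (u , j) (v , j') =
  (j ≡ j' × E j u v ≡ true) ⊎ (u ≡ v × toℕ j' ≡ suc (toℕ j))

w' : ∀ {n T} → (Fin n → Fin n → ℚ) → V' n T → V' n T → ℚ
w' w (u , j) (v , j') = if ⌊ j F.≟ j' ⌋ then w u v else 0ℚ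

Subgraph' : ℕ → ℕ → Set
Subgraph' n T = V' n T → V' n T → Bool

cost' : ∀ {n T} → (Fin n → Fin n → ℚ) → Subgraph' n T → ℚ
cost' {n} {T} w H =
  sumFin n λ u → sumFin T λ j → sumFin n λ v → sumFin T λ j' →
    if H (u , j) (v , j') then w' w (u , j) (v , j') else 0ℚ

-- Forgetting the layer index sends a path of G' to a path of G: an edge (u^j, v^j)
-- becomes (u, v) ∈ E_j and an edge (v^j, v^{j+1}) collapses to a point. Layers never
-- decrease along a path of G', so a path ending in layer t_i only uses edges of frames
-- j ≤ t_i, which lie in E_{t_i} by monotonicity. Keeping (u, v) whenever some copy
-- (u^j, v^j) of it is in H' costs at most the cost of H', as weights are nonnegative.
module Submission where

open import Defs
open import Data.Nat using (ℕ; suc)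
open import Data.Fin using (Fin; zero)
open import Data.Bool using (true)
open import Data.Product using (_×_; _,_; ∃-syntax)
open import Data.Rational using (ℚ; 0ℚ; _≤_)
open import Relation.Binary.PropositionalEquality using (_≡_)

open import Data.Nat as ℕ using (zero)
import Data.Nat.Properties as ℕ
open import Data.Fin as F using (toℕ; suc)
open import Data.Fin.Properties using (any?)
open import Data.Bool using (false; if_then_else_; _≟_)
open import Data.Bool.Properties using (T-≡)
open import Data.Product using (proj₁)
open import Data.Sum using (_⊎_; inj₁; inj₂)
open import Function using (Equivalence)
open import Relation.Nullary using (yes; no; contradiction)
open import Relation.Nullary.Decidable using (isYes; toWitness; fromWitness)
open import Relation.Binary.PropositionalEquality using (refl; sym; cong; subst; module ≡-Reasoning)
open import Data.Rational using (_+_)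
import Data.Rational.Properties as ℚ
open import Algebra.Properties.CommutativeMonoid.Sum ℚ.+-0-commutativeMonoid
  using (sum; sum-cong-≗; ∑-comm)

sumFin≡sum : ∀ n (f : Fin n → ℚ) → sumFin n f ≡ sum f
sumFin≡sum zero    f = refl
sumFin≡sum (suc n) f = cong (f zero +_) (sumFin≡sum n (λ i → f (suc i)))

sumFin-comm : ∀ m n (f : Fin m → Fin n → ℚ) →
              sumFin m (λ i → sumFin n (f i)) ≡ sumFin n (λ j → sumFin m (λ i → f i j))
sumFin-comm m n f = begin
  sumFin m (λ i → sumFin n (f i))        ≡⟨ sumFin≡sum m _ ⟩
  sum (λ i → sumFin n (f i))             ≡⟨ sum-cong-≗ (λ i → sumFin≡sum n (f i)) ⟩
  sum (λ i → sum (f i))                  ≡⟨ ∑-comm f ⟩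
  sum (λ j → sum (λ i → f i j))          ≡⟨ sum-cong-≗ (λ j → sym (sumFin≡sum m (λ i → f i j))) ⟩
  sum (λ j → sumFin m (λ i → f i j))     ≡⟨ sym (sumFin≡sum n _) ⟩
  sumFin n (λ j → sumFin m (λ i → f i j)) ∎
  where open ≡-Reasoning

sumFin-mono : ∀ n {f g : Fin n → ℚ} → (∀ i → f i ≤ g i) → sumFin n f ≤ sumFin n g
sumFin-mono zero    f≤g = ℚ.≤-refl
sumFin-mono (suc n) f≤g = ℚ.+-mono-≤ (f≤g zero) (sumFin-mono n (λ i → f≤g (suc i)))

sumFin-nonneg : ∀ n {f : Fin n → ℚ} → (∀ i → 0ℚ ≤ f i) → 0ℚ ≤ sumFin n f
sumFin-nonneg zero    f≥0 = ℚ.≤-refl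
sumFin-nonneg (suc n) f≥0 = ℚ.+-mono-≤ (f≥0 zero) (sumFin-nonneg n (λ i → f≥0 (suc i)))

≤-sumFin : ∀ n {f : Fin n → ℚ} → (∀ i → 0ℚ ≤ f i) → ∀ j → f j ≤ sumFin n f
≤-sumFin (suc n) {f} f≥0 zero = begin
  f zero                ≡⟨ sym (ℚ.+-identityʳ (f zero)) ⟩
  f zero + 0ℚ           ≤⟨ ℚ.+-monoʳ-≤ (f zero) (sumFin-nonneg n (λ i → f≥0 (suc i))) ⟩
  sumFin (suc n) f      ∎
  where open ℚ.≤-Reasoning
≤-sumFin (suc n) {f} f≥0 (suc j) = begin
  f (suc j)                          ≤⟨ ≤-sumFin n (λ i → f≥0 (suc i)) j ⟩
  sumFin n (λ i → f (suc i))         ≡⟨ sym (ℚ.+-identityˡ _) ⟩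
  0ℚ + sumFin n (λ i → f (suc i))    ≤⟨ ℚ.+-monoˡ-≤ _ (f≥0 zero) ⟩
  sumFin (suc n) f                   ∎
  where open ℚ.≤-Reasoning

module _ {V : Set} {R : V → V → Set} where

  Path-mono : (h : V → ℕ) → (∀ {x y} → R x y → h x ℕ.≤ h y) →
              ∀ {x y} → Path R x y → h x ℕ.≤ h y
  Path-mono h mono here       = ℕ.≤-refl
  Path-mono h mono (step r p) = ℕ.≤-trans (mono r) (Path-mono h mono p)

  Path-below : (h : V → ℕ) → (∀ {x y} → R x y → h x ℕ.≤ h y) →
               ∀ {x y} → Path R x y → Path (λ u v → R u v × h v ℕ.≤ h y) x y
  Path-below h mono here       = here
  Path-below h mono (step r p) = step (r , Path-mono h mono p) (Path-below h mono p)

  Path-collapse : {W : Set} {S : W → W → Set} (g : V → W) →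
                  (∀ {x y} → R x y → S (g x) (g y) ⊎ g x ≡ g y) →
                  ∀ {x y} → Path R x y → Path S (g x) (g y)
  Path-collapse g collapse here = here
  Path-collapse {S = S} g collapse {y = z} (step r p) with collapse r
  ... | inj₁ s  = step s (Path-collapse g collapse p)
  ... | inj₂ eq = subst (λ x → Path S x (g z)) (sym eq) (Path-collapse g collapse p)

module _ {n L : ℕ} (E : Frames n L) where

  layer : V' n L → ℕ
  layer (_ , j) = toℕ j

  Edge'-layer-mono : ∀ {x y} → Edge' E x y → layer x ℕ.≤ layer y
  Edge'-layer-mono (inj₁ (refl , _))   = ℕ.≤-refl
  Edge'-layer-mono (inj₂ (_ , j'≡1+j)) = ℕ.≤-trans (ℕ.n≤1+n _) (ℕ.≤-reflexive (sym j'≡1+j))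

  Edge'-within-layer : ∀ {u v j} → Edge' E (u , j) (v , j) → E j u v ≡ true
  Edge'-within-layer (inj₁ (_ , e))     = e
  Edge'-within-layer (inj₂ (_ , j≡1+j)) = contradiction (sym j≡1+j) ℕ.1+n≢n

flatten : ∀ {n L} → Subgraph' n L → Subgraph n
flatten H' u v = isYes (any? λ j → H' (u , j) (v , j) ≟ true)

flatten-intro : ∀ {n L} (H' : Subgraph' n L) {u v} j →
                H' (u , j) (v , j) ≡ true → flatten H' u v ≡ true
flatten-intro H' j e = Equivalence.to T-≡ (fromWitness (j , e))

flatten-elim : ∀ {n L} (H' : Subgraph' n L) {u v} →
               flatten H' u v ≡ true → ∃[ j ] (H' (u , j) (v , j) ≡ true)
flatten-elim H' {u} {v} e =
  toWitness {a? = any? λ j → H' (u , j) (v , j) ≟ true} (Equivalence.from T-≡ e)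

module _ {n L : ℕ} (w : Fin n → Fin n → ℚ) (w≥0 : ∀ u v → 0ℚ ≤ w u v)
         (H' : Subgraph' n L) where

  weight' : Fin n → Fin L → Fin n → Fin L → ℚ
  weight' u j v j' = if H' (u , j) (v , j') then w' w (u , j) (v , j') else 0ℚ

  weight'-nonneg : ∀ u j v j' → 0ℚ ≤ weight' u j v j'
  weight'-nonneg u j v j' with H' (u , j) (v , j') | j F.≟ j'
  ... | true  | yes _ = w≥0 u v
  ... | true  | no _  = ℚ.≤-refl
  ... | false | _     = ℚ.≤-refl

  weight'-within-layer : ∀ {u v} j → H' (u , j) (v , j) ≡ true → weight' u j v j ≡ w u v
  weight'-within-layer {u} {v} j e with j F.≟ j
  ... | yes _  rewrite e = refl
  ... | no j≢j = contradiction refl j≢j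

  flatten-weight-≤ : ∀ u v → (if flatten H' u v then w u v else 0ℚ) ≤
                             sumFin L (λ j → sumFin L (weight' u j v))
  flatten-weight-≤ u v with flatten H' u v in e
  ... | false = sumFin-nonneg L (λ j → sumFin-nonneg L (weight'-nonneg u j v))
  ... | true with flatten-elim H' e
  ... | j , ej = begin
    w u v                                     ≡⟨ sym (weight'-within-layer j ej) ⟩
    weight' u j v j                           ≤⟨ ≤-sumFin L (weight'-nonneg u j v) j ⟩
    sumFin L (weight' u j v)                  ≤⟨ ≤-sumFin L (λ i → sumFin-nonneg L (weight'-nonneg u i v)) j ⟩
    sumFin L (λ i → sumFin L (weight' u i v)) ∎
    where open ℚ.≤-Reasoning

  cost-flatten-≤ : cost w (flatten H') ≤ cost' w H'
  cost-flatten-≤ = sumFin-mono n λ u → begin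
    sumFin n (λ v → if flatten H' u v then w u v else 0ℚ)     ≤⟨ sumFin-mono n (flatten-weight-≤ u) ⟩
    sumFin n (λ v → sumFin L λ j → sumFin L (weight' u j v)) ≡⟨ sumFin-comm n L _ ⟩
    sumFin L (λ j → sumFin n λ v → sumFin L (weight' u j v)) ∎
    where open ℚ.≤-Reasoning

flatten-edge-below : ∀ {n L} {E : Frames n L} → Monotone E → (H' : Subgraph' n L) →
                     (∀ x y → H' x y ≡ true → Edge' E x y) →
                     ∀ t {u j v j'} → H' (u , j) (v , j') ≡ true → toℕ j' ℕ.≤ toℕ t →
                     (flatten H' u v ≡ true × E t u v ≡ true) ⊎ u ≡ v
flatten-edge-below mono H' H'⊆G' t {u} {j} {v} e j'≤t with H'⊆G' _ _ e
... | inj₁ (refl , ej) = inj₁ (flatten-intro H' j e , mono j t u v j'≤t ej)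
... | inj₂ (u≡v , _)   = inj₂ u≡v

lemma16 : (n T k : ℕ) (E : Frames n (suc T)) → Monotone E →
          (w : Fin n → Fin n → ℚ) → (∀ u v → 0ℚ ≤ w u v) →
          (a : Fin n) (b : Fin k → Fin n) (t : Fin k → Fin (suc T)) →
          (H' : Subgraph' n (suc T)) →
          (∀ x y → H' x y ≡ true → Edge' E x y) →
          (∀ i → Path (λ x y → H' x y ≡ true) (a , zero) (b i , t i)) →
          ∃[ H ] ((∀ u v → H u v ≡ true → InUnion E u v)
                  × (∀ i → Path (λ x y → H x y ≡ true × E (t i) x y ≡ true) a (b i))
                  × cost w H ≤ cost' w H')
lemma16 n T k E mono w w≥0 a b t H' H'⊆G' paths =
  flatten H' , flatten-⊆-union , flatten-path , cost-flatten-≤ w w≥0 H'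
  where
  flatten-⊆-union : ∀ u v → flatten H' u v ≡ true → InUnion E u v
  flatten-⊆-union u v e with flatten-elim H' e
  ... | j , ej = j , Edge'-within-layer E (H'⊆G' _ _ ej)

  flatten-path : ∀ i → Path (λ x y → flatten H' x y ≡ true × E (t i) x y ≡ true) a (b i)
  flatten-path i =
    Path-collapse proj₁ (λ (e , below) → flatten-edge-below mono H' H'⊆G' (t i) e below)
      (Path-below (layer E) (λ e → Edge'-layer-mono E (H'⊆G' _ _ e)) (paths i))
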